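{- The desuspension preserves derivability: if $\Gamma\vdash_{\mathsf{CaTT}}$ then $\mathrm{D}\Gamma\vdash_{\mathsf{MCaTT}}$; if $\Gamma\vdash_{\mathsf{CaTT}}A$ then $\mathrm{D}\Gamma\vdash_{\mathsf{MCaTT}}\mathrm{D}A$; if $\Gamma\vdash_{\mathsf{CaTT}}t:A$ then $\mathrm{D}\Gamma\vdash_{\mathsf{MCaTT}}\mathrm{D}t:\mathrm{D}A$; and if $\Delta\vdash_{\mathsf{CaTT}}\gamma:\Gamma$ then $\mathrm{D}\Delta\vdash_{\mathsf{MCaTT}}\mathrm{D}\gamma:\mathrm{D}\Gamma$.
   Context: $\mathsf{CaTT}$ is the Finster–Mimram type theory for weak $\omega$-categories, with types $\star$ and $\mathrm{Hom}_Atu$ and terms variables, $\mathsf{op}_{\Gamma,A}[\gamma]$, $\mathsf{coh}_{\Gamma,A}[\gamma]$ ($\Gamma$ a ps-context). $\mathsf{MCaTT}$ is the type theory with a unit type $\mathbb{1}$ (constant $()$, $\eta$-rule making every term of type $\mathbb{1}$ definitionally equal to $()$), types $\mathrm{Hom}_Atu$, and term constructors $\mathsf{mop}_{\Gamma,A}[\gamma]$, $\mathsf{mcoh}_{\Gamma,A}[\gamma]$, introduced when $\Gamma$ is a ps-context, $\Gamma\vdash_{\mathrm{op}}A$ (resp. $\Gamma\vdash_{\mathrm{eq}}A$) in $\mathsf{CaTT}$ and $\Delta\vdash\gamma:\mathrm{D}\Gamma$, with type $(\mathrm{D}A)[\gamma]$. The desuspension $\mathrm{D}$ is the operation on raw expressions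 of $\mathsf{CaTT}$ given by $\mathrm{D}\emptyset=\emptyset$, $\mathrm{D}(\Gamma,x:A)=(\mathrm{D}\Gamma,x:\mathrm{D}A)$, $\mathrm{D}\star=\mathbb{1}$, $\mathrm{D}(\mathrm{Hom}_Atu)=\mathrm{Hom}_{\mathrm{D}A}(\mathrm{D}t)(\mathrm{D}u)$, $\mathrm{D}x=x$, $\mathrm{D}(\mathsf{op}_{\Gamma,A}[\gamma])=\mathsf{mop}_{\Gamma,A}[\mathrm{D}\gamma]$, $\mathrm{D}(\mathsf{coh}_{\Gamma,A}[\gamma])=\mathsf{mcoh}_{\Gamma,A}[\mathrm{D}\gamma]$, $\mathrm{D}\langle\rangle=\langle\rangle$, $\mathrm{D}\langle\gamma,x\mapsto t\rangle=\langle\mathrm{D}\gamma,x\mapsto\mathrm{D}t\rangle$. -}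

module Defs where

open import Data.Nat using (ℕ; zero; suc; _≡ᵇ_; _⊔_; _≤ᵇ_; _<ᵇ_)
open import Data.Bool using (Bool; true; false; if_then_else_)
open import Data.List using (List; []; _∷_; _++_)
open import Data.List.Membership.Propositional using (_∈_; _∉_)
open import Data.Product using (_×_)
open import Relation.Binary.PropositionalEquality using (_≡_)
open import Relation.Nullary using (¬_)

Name : Set
Name = ℕ

infixl 5 _▸_∶_
infixl 5 _,,_↦_

mutual
  data Ty : Set where
    ⋆   : Ty
    Hom : Ty → Tm → Tm → Ty

  data Tm : Set where
    var : Name → Tm
    op  : Ctx → Ty → Sub → Tm
    coh : Ctx → Ty → Sub → Tm

  data Sub : Set where
    ⟨⟩     : Sub
    _,,_↦_ : Sub → Name → Tm → Sub

  data Ctx : Set where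
    ∅     : Ctx
    _▸_∶_ : Ctx → Name → Ty → Ctx

-- application of substitutions (raw); unbound variables are left untouched
lookupSub : Name → Sub → Tm
lookupSub x ⟨⟩ = var x
lookupSub x (γ ,, y ↦ t) = if x ≡ᵇ y then t else lookupSub x γ

mutual
  _[_]Ty : Ty → Sub → Ty
  ⋆ [ γ ]Ty = ⋆
  Hom A t u [ γ ]Ty = Hom (A [ γ ]Ty) (t [ γ ]Tm) (u [ γ ]Tm)

  _[_]Tm : Tm → Sub → Tm
  var x [ γ ]Tm = lookupSub x γ
  op Γ A δ [ γ ]Tm = op Γ A (δ ∘ γ)
  coh Γ A δ [ γ ]Tm = coh Γ A (δ ∘ γ)

  -- δ ∘ γ  =  δ[γ]
  _∘_ : Sub → Sub → Sub
  ⟨⟩ ∘ γ = ⟨⟩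
  (δ ,, x ↦ t) ∘ γ = (δ ∘ γ) ,, x ↦ (t [ γ ]Tm)

mutual
  VarTy : Ty → List Name
  VarTy ⋆ = []
  VarTy (Hom A t u) = VarTy A ++ VarTm t ++ VarTm u

  VarTm : Tm → List Name
  VarTm (var x) = x ∷ []
  VarTm (op Γ A γ) = VarSub γ
  VarTm (coh Γ A γ) = VarSub γ

  VarSub : Sub → List Name
  VarSub ⟨⟩ = []
  VarSub (γ ,, x ↦ t) = VarSub γ ++ VarTm t

VarCtx : Ctx → List Name
VarCtx ∅ = []
VarCtx (Γ ▸ x ∶ A) = VarCtx Γ ++ (x ∷ [])

SameVars : List Name → List Name → Set
SameVars xs ys = (∀ z → z ∈ xs → z ∈ ys) × (∀ z → z ∈ ys → z ∈ xs)

data _∋_∶_ : Ctx → Name → Ty → Set where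
  here  : ∀ {Γ x A} → (Γ ▸ x ∶ A) ∋ x ∶ A
  there : ∀ {Γ x A y B} → Γ ∋ x ∶ A → (Γ ▸ y ∶ B) ∋ x ∶ A

-- Dimension and boundaries of pasting schemes (Finster–Mimram)

dimTy : Ty → ℕ
dimTy ⋆ = 0
dimTy (Hom A t u) = suc (dimTy A)

dimCtx : Ctx → ℕ
dimCtx ∅ = 0
dimCtx (Γ ▸ x ∶ A) = dimCtx Γ ⊔ dimTy A

dropLast : Ctx → Ctx
dropLast ∅ = ∅
dropLast (Γ ▸ x ∶ A) = Γ

∂⁻[_] : ℕ → Ctx → Ctx
∂⁻[ i ] ∅ = ∅
∂⁻[ i ] (∅ ▸ x ∶ A) = ∅ ▸ x ∶ A
∂⁻[ i ] (Γ ▸ y ∶ A ▸ f ∶ B) =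
  if i ≤ᵇ dimTy A then ∂⁻[ i ] Γ else (∂⁻[ i ] Γ ▸ y ∶ A ▸ f ∶ B)

∂⁺[_] : ℕ → Ctx → Ctx
∂⁺[ i ] ∅ = ∅
∂⁺[ i ] (∅ ▸ x ∶ A) = ∅ ▸ x ∶ A
∂⁺[ i ] (Γ ▸ y ∶ A ▸ f ∶ B) =
  if i <ᵇ dimTy A then ∂⁺[ i ] Γ
  else (if dimTy A ≡ᵇ i then (dropLast (∂⁺[ i ] Γ) ▸ y ∶ A)
        else (∂⁺[ i ] Γ ▸ y ∶ A ▸ f ∶ B))

-- ∂⁻Γ = ∂⁻_{dim Γ - 1} Γ and ∂⁺Γ = ∂⁺_{dim Γ - 1} Γ
-- (for dim Γ = 0 the boundary is taken to be empty)
src : Ctx → Ctx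
src Γ with dimCtx Γ
... | zero  = ∅
... | suc i = ∂⁻[ i ] Γ

tgt : Ctx → Ctx
tgt Γ with dimCtx Γ
... | zero  = ∅
... | suc i = ∂⁺[ i ] Γ

-- ps-contexts:  Γ ⊢ps x : A  and  Γ ⊢ps
data PSJ : Ctx → Name → Ty → Set where
  pss : ∀ {x} → PSJ (∅ ▸ x ∶ ⋆) x ⋆
  psd : ∀ {Γ f A x y} → PSJ Γ f (Hom A x (var y)) → PSJ Γ y A
  pse : ∀ {Γ x A y f} → PSJ Γ x A →
        y ∉ VarCtx Γ → f ∉ VarCtx Γ → ¬ (y ≡ f) →
        PSJ (Γ ▸ y ∶ A ▸ f ∶ Hom A (var x) (var y)) f (Hom A (var x) (var y))

data PS : Ctx → Set where
  ps : ∀ {Γ x} → PSJ Γ x ⋆ → PS Γ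

mutual
  data CtxC : Ctx → Set where
    c∅ : CtxC ∅
    c▸ : ∀ {Γ x A} → TyC Γ A → x ∉ VarCtx Γ → CtxC (Γ ▸ x ∶ A)

  data TyC : Ctx → Ty → Set where
    t⋆   : ∀ {Γ} → CtxC Γ → TyC Γ ⋆
    tHom : ∀ {Γ A t u} → TmC Γ t A → TmC Γ u A → TyC Γ (Hom A t u)

  data TmC : Ctx → Tm → Ty → Set where
    tvar : ∀ {Γ x A} → CtxC Γ → Γ ∋ x ∶ A → TmC Γ (var x) A
    top  : ∀ {Γ A Δ γ} → PS Γ → OpC Γ A → SubC Δ γ Γ →
           TmC Δ (op Γ A γ) (A [ γ ]Ty)
    tcoh : ∀ {Γ A Δ γ} → PS Γ → EqC Γ A → SubC Δ γ Γ →
           TmC Δ (coh Γ A γ) (A [ γ ]Ty)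

  data SubC : Ctx → Sub → Ctx → Set where
    s⟨⟩ : ∀ {Δ} → CtxC Δ → SubC Δ ⟨⟩ ∅
    s,  : ∀ {Δ γ Γ x A t} → SubC Δ γ Γ → CtxC (Γ ▸ x ∶ A) →
          TmC Δ t (A [ γ ]Ty) → SubC Δ (γ ,, x ↦ t) (Γ ▸ x ∶ A)

  data OpC : Ctx → Ty → Set where
    isOp : ∀ {Γ B t u} →
           TmC (src Γ) t B → TmC (tgt Γ) u B →
           SameVars (VarTm t ++ VarTy B) (VarCtx (src Γ)) →
           SameVars (VarTm u ++ VarTy B) (VarCtx (tgt Γ)) →
           OpC Γ (Hom B t u)

  data EqC : Ctx → Ty → Set where
    isEq : ∀ {Γ B t u} →
           TmC Γ t B → TmC Γ u B →
           SameVars (VarTm t ++ VarTy B) (VarCtx Γ) →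
           SameVars (VarTm u ++ VarTy B) (VarCtx Γ) →
           EqC Γ (Hom B t u)

infixl 5 _▸ₘ_∶_
infixl 5 _,,ₘ_↦_

mutual
  data MTy : Set where
    𝟙    : MTy
    MHom : MTy → MTm → MTm → MTy

  data MTm : Set where
    mvar : Name → MTm
    tt   : MTm
    mop  : Ctx → Ty → MSub → MTm
    mcoh : Ctx → Ty → MSub → MTm

  data MSub : Set where
    ⟨⟩ₘ     : MSub
    _,,ₘ_↦_ : MSub → Name → MTm → MSub

data MCtx : Set where
  ∅ₘ     : MCtx
  _▸ₘ_∶_ : MCtx → Name → MTy → MCtx

lookupMSub : Name → MSub → MTm
lookupMSub x ⟨⟩ₘ = mvar x
lookupMSub x (γ ,,ₘ y ↦ t) = if x ≡ᵇ y then t else lookupMSub x γ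

mutual
  _[_]MTy : MTy → MSub → MTy
  𝟙 [ γ ]MTy = 𝟙
  MHom A t u [ γ ]MTy = MHom (A [ γ ]MTy) (t [ γ ]MTm) (u [ γ ]MTm)

  _[_]MTm : MTm → MSub → MTm
  mvar x [ γ ]MTm = lookupMSub x γ
  tt [ γ ]MTm = tt
  mop Γ A δ [ γ ]MTm = mop Γ A (δ ∘ₘ γ)
  mcoh Γ A δ [ γ ]MTm = mcoh Γ A (δ ∘ₘ γ)

  _∘ₘ_ : MSub → MSub → MSub
  ⟨⟩ₘ ∘ₘ γ = ⟨⟩ₘ
  (δ ,,ₘ x ↦ t) ∘ₘ γ = (δ ∘ₘ γ) ,,ₘ x ↦ (t [ γ ]MTm)

VarMCtx : MCtx → List Name
VarMCtx ∅ₘ = []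
VarMCtx (Γ ▸ₘ x ∶ A) = VarMCtx Γ ++ (x ∷ [])

data _∋ₘ_∶_ : MCtx → Name → MTy → Set where
  here  : ∀ {Γ x A} → (Γ ▸ₘ x ∶ A) ∋ₘ x ∶ A
  there : ∀ {Γ x A y B} → Γ ∋ₘ x ∶ A → (Γ ▸ₘ y ∶ B) ∋ₘ x ∶ A

mutual
  DTy : Ty → MTy
  DTy ⋆ = 𝟙
  DTy (Hom A t u) = MHom (DTy A) (DTm t) (DTm u)

  DTm : Tm → MTm
  DTm (var x) = mvar x
  DTm (op Γ A γ) = mop Γ A (DSub γ)
  DTm (coh Γ A γ) = mcoh Γ A (DSub γ)

  DSub : Sub → MSub
  DSub ⟨⟩ = ⟨⟩ₘ
  DSub (γ ,, x ↦ t) = DSub γ ,,ₘ x ↦ DTm t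

DCtx : Ctx → MCtx
DCtx ∅ = ∅ₘ
DCtx (Γ ▸ x ∶ A) = DCtx Γ ▸ₘ x ∶ DTy A

mutual
  data CtxM : MCtx → Set where
    c∅ : CtxM ∅ₘ
    c▸ : ∀ {Γ x A} → TyM Γ A → x ∉ VarMCtx Γ → CtxM (Γ ▸ₘ x ∶ A)

  data TyM : MCtx → MTy → Set where
    t𝟙   : ∀ {Γ} → CtxM Γ → TyM Γ 𝟙
    tHom : ∀ {Γ A t u} → TmM Γ t A → TmM Γ u A → TyM Γ (MHom A t u)

  data TmM : MCtx → MTm → MTy → Set where
    tvar  : ∀ {Γ x A} → CtxM Γ → Γ ∋ₘ x ∶ A → TmM Γ (mvar x) A
    ttt   : ∀ {Γ} → CtxM Γ → TmM Γ tt 𝟙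
    tmop  : ∀ {Γ A Δ γ} → PS Γ → OpC Γ A → SubM Δ γ (DCtx Γ) →
            TmM Δ (mop Γ A γ) (DTy A [ γ ]MTy)
    tmcoh : ∀ {Γ A Δ γ} → PS Γ → EqC Γ A → SubM Δ γ (DCtx Γ) →
            TmM Δ (mcoh Γ A γ) (DTy A [ γ ]MTy)
    tconv : ∀ {Γ t A B} → TmM Γ t A → TyEqM Γ A B → TmM Γ t B

  data SubM : MCtx → MSub → MCtx → Set where
    s⟨⟩ : ∀ {Δ} → CtxM Δ → SubM Δ ⟨⟩ₘ ∅ₘ
    s,  : ∀ {Δ γ Γ x A t} → SubM Δ γ Γ → CtxM (Γ ▸ₘ x ∶ A) →
          TmM Δ t (A [ γ ]MTy) → SubM Δ (γ ,,ₘ x ↦ t) (Γ ▸ₘ x ∶ A)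

  data TyEqM : MCtx → MTy → MTy → Set where
    e𝟙    : ∀ {Γ} → CtxM Γ → TyEqM Γ 𝟙 𝟙
    eHom  : ∀ {Γ A A' t t' u u'} → TyEqM Γ A A' →
            TmEqM Γ t t' A → TmEqM Γ u u' A →
            TyEqM Γ (MHom A t u) (MHom A' t' u')
    esym  : ∀ {Γ A B} → TyEqM Γ A B → TyEqM Γ B A
    etrans : ∀ {Γ A B C} → TyEqM Γ A B → TyEqM Γ B C → TyEqM Γ A C

  data TmEqM : MCtx → MTm → MTm → MTy → Set where
    erefl  : ∀ {Γ t A} → TmM Γ t A → TmEqM Γ t t A
    esym   : ∀ {Γ t u A} → TmEqM Γ t u A → TmEqM Γ u t A
    etrans : ∀ {Γ t u v A} → TmEqM Γ t u A → TmEqM Γ u v A → TmEqM Γ t v A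
    eη     : ∀ {Γ t} → TmM Γ t 𝟙 → TmEqM Γ t tt 𝟙
    econv  : ∀ {Γ t u A B} → TmEqM Γ t u A → TyEqM Γ A B → TmEqM Γ t u B
    emop   : ∀ {Γ A Δ γ γ'} → PS Γ → OpC Γ A → SubEqM Δ γ γ' (DCtx Γ) →
             TmEqM Δ (mop Γ A γ) (mop Γ A γ') (DTy A [ γ ]MTy)
    emcoh  : ∀ {Γ A Δ γ γ'} → PS Γ → EqC Γ A → SubEqM Δ γ γ' (DCtx Γ) →
             TmEqM Δ (mcoh Γ A γ) (mcoh Γ A γ') (DTy A [ γ ]MTy)

  data SubEqM : MCtx → MSub → MSub → MCtx → Set where
    e⟨⟩ : ∀ {Δ} → CtxM Δ → SubEqM Δ ⟨⟩ₘ ⟨⟩ₘ ∅ₘ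
    e,  : ∀ {Δ γ γ' Γ x A t t'} → SubEqM Δ γ γ' Γ → CtxM (Γ ▸ₘ x ∶ A) →
          TmEqM Δ t t' (A [ γ ]MTy) →
          SubEqM Δ (γ ,,ₘ x ↦ t) (γ' ,,ₘ x ↦ t') (Γ ▸ₘ x ∶ A)

{-# OPTIONS --safe #-}
-- D commutes with substitution syntactically, so every CaTT rule is sent
-- to the corresponding MCaTT rule.

module Submission where

open import Defs
open import Data.Bool using (true; false)
open import Data.List using ([]; _∷_; _++_)
open import Data.List.Membership.Propositional using (_∉_)
open import Data.Nat using (_≡ᵇ_)
open import Data.Product using (_×_; _,_)
open import Relation.Binary.PropositionalEquality
  using (_≡_; refl; cong; cong₂; subst; sym)

DTm-lookupSub : ∀ x γ → DTm (lookupSub x γ) ≡ lookupMSub x (DSub γ)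
DTm-lookupSub x ⟨⟩ = refl
DTm-lookupSub x (γ ,, y ↦ t) with x ≡ᵇ y
... | true  = refl
... | false = DTm-lookupSub x γ

mutual
  DTy-[]Ty : ∀ A γ → DTy (A [ γ ]Ty) ≡ DTy A [ DSub γ ]MTy
  DTy-[]Ty ⋆ γ = refl
  DTy-[]Ty (Hom A t u) γ
    rewrite DTy-[]Ty A γ | DTm-[]Tm t γ | DTm-[]Tm u γ = refl

  DTm-[]Tm : ∀ t γ → DTm (t [ γ ]Tm) ≡ DTm t [ DSub γ ]MTm
  DTm-[]Tm (var x)     γ = DTm-lookupSub x γ
  DTm-[]Tm (op Γ A δ)  γ = cong (mop Γ A) (DSub-∘ δ γ)
  DTm-[]Tm (coh Γ A δ) γ = cong (mcoh Γ A) (DSub-∘ δ γ)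

  DSub-∘ : ∀ δ γ → DSub (δ ∘ γ) ≡ DSub δ ∘ₘ DSub γ
  DSub-∘ ⟨⟩           γ = refl
  DSub-∘ (δ ,, x ↦ t) γ = cong₂ (_,,ₘ x ↦_) (DSub-∘ δ γ) (DTm-[]Tm t γ)

VarMCtx-DCtx : ∀ Γ → VarMCtx (DCtx Γ) ≡ VarCtx Γ
VarMCtx-DCtx ∅           = refl
VarMCtx-DCtx (Γ ▸ x ∶ A) = cong (_++ x ∷ []) (VarMCtx-DCtx Γ)

D-∋ : ∀ {Γ x A} → Γ ∋ x ∶ A → DCtx Γ ∋ₘ x ∶ DTy A
D-∋ here      = here
D-∋ (there p) = there (D-∋ p)

mutual
  D-CtxC : ∀ {Γ} → CtxC Γ → CtxM (DCtx Γ)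
  D-CtxC c∅ = c∅
  D-CtxC (c▸ {Γ} {x} ⊢A x∉Γ) =
    c▸ (D-TyC ⊢A) (subst (x ∉_) (sym (VarMCtx-DCtx Γ)) x∉Γ)

  D-TyC : ∀ {Γ A} → TyC Γ A → TyM (DCtx Γ) (DTy A)
  D-TyC (t⋆ ⊢Γ)     = t𝟙 (D-CtxC ⊢Γ)
  D-TyC (tHom ⊢t ⊢u) = tHom (D-TmC ⊢t) (D-TmC ⊢u)

  D-TmC : ∀ {Γ t A} → TmC Γ t A → TmM (DCtx Γ) (DTm t) (DTy A)
  D-TmC (tvar ⊢Γ x∈Γ) = tvar (D-CtxC ⊢Γ) (D-∋ x∈Γ)
  D-TmC (top {A = A} {γ = γ} Γps ⊢op ⊢γ) =
    subst (TmM _ _) (sym (DTy-[]Ty A γ)) (tmop Γps ⊢op (D-SubC ⊢γ))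
  D-TmC (tcoh {A = A} {γ = γ} Γps ⊢eq ⊢γ) =
    subst (TmM _ _) (sym (DTy-[]Ty A γ)) (tmcoh Γps ⊢eq (D-SubC ⊢γ))

  D-SubC : ∀ {Δ γ Γ} → SubC Δ γ Γ → SubM (DCtx Δ) (DSub γ) (DCtx Γ)
  D-SubC (s⟨⟩ ⊢Δ) = s⟨⟩ (D-CtxC ⊢Δ)
  D-SubC (s, {γ = γ} {A = A} ⊢γ ⊢Γx ⊢t) =
    s, (D-SubC ⊢γ) (D-CtxC ⊢Γx) (subst (TmM _ _) (DTy-[]Ty A γ) (D-TmC ⊢t))

mainTheorem6 :
    (∀ Γ → CtxC Γ → CtxM (DCtx Γ)) ×
    (∀ Γ A → TyC Γ A → TyM (DCtx Γ) (DTy A)) ×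
    (∀ Γ t A → TmC Γ t A → TmM (DCtx Γ) (DTm t) (DTy A)) ×
    (∀ Δ γ Γ → SubC Δ γ Γ → SubM (DCtx Δ) (DSub γ) (DCtx Γ))
mainTheorem6 =
  (λ _ → D-CtxC) , (λ _ _ → D-TyC) , (λ _ _ _ → D-TmC) , (λ _ _ _ → D-SubC)
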